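{- Let $N=pq$ with $p,q$ distinct primes such that $N\equiv 3\pmod 4$. Let $a\in\mathbb{Z}$ with $\gcd(a,N)=1$ and $\left(\frac{a}{N}\right)_2=1$. Then $a\in\mathbb{Z}_{N,2}^*$ if and only if $\left(\frac{a^2}{N}\right)_4=1$.
   Context: For $k\in\mathbb{N}_0$, a prime $p$ and $a\in\mathbb{Z}$ with $p\nmid a$, $\left(\frac{a}{p}\right)_{2^k}=1$ if there is $x\in\mathbb{Z}$ with $x^{2^k}\equiv a \pmod p$, and $-1$ otherwise; for $n=p_1\cdots p_l$ (primes not necessarily distinct) with $\gcd(n,a)=1$, $\left(\frac{a}{n}\right)_{2^k}:=\prod_i\left(\frac{a}{p_i}\right)_{2^k}$. $\mathbb{Z}_{N,2}^*$ denotes the set of units modulo $N$ that are squares modulo $N$. -}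

module Defs where

open import Data.Nat using (ℕ)
open import Data.Integer using (ℤ; +_; _-_; _^_; _*_; -1ℤ; 1ℤ)
open import Data.Integer.Divisibility using (_∣_)
open import Data.Product using (∃; _×_)
open import Data.List using (List; []; _∷_)
open import Relation.Nullary using (¬_)
open import Relation.Binary.PropositionalEquality using (_≡_)

_≡_[mod_] : ℤ → ℤ → ℤ → Set
x ≡ y [mod m ] = m ∣ (x - y)

PowRes : ℕ → ℕ → ℤ → Set
PowRes k p a = ∃ λ (x : ℤ) → (x ^ (2 Data.Nat.^ k)) ≡ a [mod (+ p) ]
  where import Data.Nat

data SymbolP (k p : ℕ) (a : ℤ) : ℤ → Set where
  sym-res    : PowRes k p a → SymbolP k p a 1ℤ
  sym-nonres : ¬ PowRes k p a → SymbolP k p a -1ℤ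

-- (a/n)_{2^k} for n = p₁⋯p_l given as its list of prime factors takes the value s
-- (product of the prime symbols).
data Symbol (k : ℕ) (a : ℤ) : List ℕ → ℤ → Set where
  sym-nil  : Symbol k a [] 1ℤ
  sym-cons : ∀ {p ps s t} → SymbolP k p a s → Symbol k a ps t → Symbol k a (p ∷ ps) (s * t)

-- a ∈ ℤ*_{N,2}: a is a square modulo N (units assumed separately via gcd)
IsSquareMod : ℕ → ℤ → Set
IsSquareMod N a = ∃ λ (x : ℤ) → (x ^ 2) ≡ a [mod (+ N) ]

SymbolIsOne : ℕ → ℤ → List ℕ → Set
SymbolIsOne k a ps = ∃ λ s → Symbol k a ps s × s ≡ 1ℤ

module Submission where

-- Write N = pq with p ≡ 3 and q ≡ 1 (mod 4). Squares modulo N are exactly the integers that are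
-- squares modulo p and modulo q (Chinese remainder theorem), and (a/N)₂ = 1 says that a is a square
-- modulo both primes or modulo neither. In the first case a is a square mod N and a² is a fourth
-- power mod p and mod q, so (a²/N)₄ = 1. In the second case (a²/N)₄ = -1: by Euler's criterion
-- a^((p-1)/2) ≡ -1 (mod p), and since (p+1)/4 is an integer, a² ≡ (a^((p+1)/4))⁴ (mod p); while -1
-- is a square mod q, so y⁴ ≡ a² (mod q) would make a ≡ ±y² a square mod q. Euler's criterion itself
-- comes from pairing the residues 1, …, p-1 as {i, a/i}, and Wilson's theorem from pairing them
-- as {i, 1/i} after setting aside 1 and p-1.

open import Defs

module QuadraticResidues where

  open import Level using (0ℓ)
  open import Data.Nat as ℕ using (ℕ; zero; suc; NonZero)
  import Data.Nat.Properties as ℕ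
  import Data.Nat.DivMod as ℕ
  import Data.Nat.Divisibility as ℕ
  open import Data.Nat.GCD using (gcd; gcd-GCD; module Bézout; module GCD)
  open import Data.Nat.Coprimality as Coprime using (Coprime; coprime⇒gcd≡1; prime⇒coprime)
  open import Data.Nat.LCM using (lcm; lcm-least; gcd*lcm)
  open import Data.Nat.Primality
    using (Prime; prime⇒nonZero; prime⇒nonTrivial; prime⇒irreducible; ¬prime[1]; euclidsLemma)
  open import Data.Nat.ListAction using (product)
  open import Data.Nat.ListAction.Properties using (product-↭)
  import Data.Nat.Tactic.RingSolver as ℕ-Solver
  open import Data.Integer using (ℤ; +_; _+_; _-_; -_; _*_; _^_; 0ℤ; 1ℤ; -1ℤ; ∣_∣; _%ℕ_; _/ℕ_)
  import Data.Integer.Properties as ℤ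
  open import Data.Integer.DivMod using (a≡a%ℕn+[a/ℕn]*n; n%ℕd<d)
  open import Data.Integer.Divisibility.Signed
    using (_∣_; divides; ∣ᵤ⇒∣; ∣⇒∣ᵤ; ∣m∣n⇒∣m+n; ∣m⇒∣-m; ∣m⇒∣m*n; ∣n⇒∣m*n)
  open import Data.Integer.Tactic.RingSolver using (solve-∀)
  open import Data.Product using (_×_; _,_; proj₁; proj₂; ∃; ∃₂)
  open import Data.Sum as Sum using (_⊎_; inj₁; inj₂)
  open import Data.List using (List; []; _∷_; length; filter; applyUpTo)
  open import Data.List.Properties using (filter-accept; filter-reject; filter-all; length-applyUpTo)
  open import Data.List.Membership.Propositional using (_∈_)
  open import Data.List.Membership.Propositional.Properties
    using (∈-filter⁺; ∈-filter⁻; ∈-applyUpTo⁺; ∈-applyUpTo⁻)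
  open import Data.List.Relation.Unary.Any using (here; there)
  import Data.List.Relation.Unary.All as All
  open import Data.List.Relation.Unary.AllPairs using (_∷_)
  open import Data.List.Relation.Unary.Unique.Propositional using (Unique)
  import Data.List.Relation.Unary.Unique.Propositional.Properties as Unique
  open import Data.List.Relation.Binary.Permutation.Propositional
    using (_↭_; ↭-refl; ↭-prep; ↭-swap; ↭-trans)
  open import Data.List.Relation.Binary.Permutation.Propositional.Properties using (↭-length)
  open import Function using (_∘_; flip; id; _⇔_; mk⇔)
  open import Relation.Nullary using (¬_; Dec; ¬?; contradiction)
  open import Relation.Binary using (IsEquivalence; Setoid)
  open import Relation.Binary.PropositionalEquality
    using (_≡_; _≢_; refl; sym; trans; cong; subst; module ≡-Reasoning)
  import Relation.Binary.Reasoning.Setoid as SetoidReasoning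

  variable
    x y z u v c : ℤ
    i j n : ℕ
    xs : List ℕ

  IsSquare IsFourthPower : ℕ → ℤ → Set
  IsSquare      = PowRes 1
  IsFourthPower = PowRes 2

  x^2≡x*x : ∀ x → x ^ 2 ≡ x * x
  x^2≡x*x x = cong (x *_) (ℤ.*-identityʳ x)

  module Congruence (m : ℤ) where

    -- A record, unlike _≡_[mod_] (which unfolds to divisibility of |x - y|), determines x and y,
    -- so they can be inferred from a proof.
    infix 4 _≈_
    record _≈_ (x y : ℤ) : Set where
      constructor ∣⇒≈
      field ≈⇒∣ : m ∣ x - y
    open _≈_ public

    ≡[mod]⇒≈ : x ≡ y [mod m ] → x ≈ y
    ≡[mod]⇒≈ = ∣⇒≈ ∘ ∣ᵤ⇒∣

    ≈⇒≡[mod] : x ≈ y → x ≡ y [mod m ]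
    ≈⇒≡[mod] = ∣⇒∣ᵤ ∘ ≈⇒∣

    ≈-reflexive : x ≡ y → x ≈ y
    ≈-reflexive {x} refl = ∣⇒≈ (divides 0ℤ (trans (ℤ.+-inverseʳ x) (sym (ℤ.*-zeroˡ m))))

    ≈-refl : x ≈ x
    ≈-refl = ≈-reflexive refl

    ≈-sym : x ≈ y → y ≈ x
    ≈-sym {x} {y} x≈y = ∣⇒≈ (subst (m ∣_) (negate x y) (∣m⇒∣-m (≈⇒∣ x≈y)))
      where
      negate : ∀ x y → - (x - y) ≡ y - x
      negate = solve-∀

    ≈-trans : x ≈ y → y ≈ z → x ≈ z
    ≈-trans {x} {y} {z} x≈y y≈z =
      ∣⇒≈ (subst (m ∣_) (telescope x y z) (∣m∣n⇒∣m+n (≈⇒∣ x≈y) (≈⇒∣ y≈z)))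
      where
      telescope : ∀ x y z → (x - y) + (y - z) ≡ x - z
      telescope = solve-∀

    ≈-isEquivalence : IsEquivalence _≈_
    ≈-isEquivalence = record { refl = ≈-refl ; sym = ≈-sym ; trans = ≈-trans }

    ≈-setoid : Setoid 0ℓ 0ℓ
    ≈-setoid = record { isEquivalence = ≈-isEquivalence }

    module ≈-Reasoning = SetoidReasoning ≈-setoid

    +-cong : x ≈ y → u ≈ v → x + u ≈ y + v
    +-cong {x} {y} {u} {v} x≈y u≈v =
      ∣⇒≈ (subst (m ∣_) (regroup x y u v) (∣m∣n⇒∣m+n (≈⇒∣ x≈y) (≈⇒∣ u≈v)))
      where
      regroup : ∀ x y u v → (x - y) + (u - v) ≡ (x + u) - (y + v)
      regroup = solve-∀

    -‿cong : x ≈ y → - x ≈ - y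
    -‿cong {x} {y} x≈y = ∣⇒≈ (subst (m ∣_) (negate x y) (∣m⇒∣-m (≈⇒∣ x≈y)))
      where
      negate : ∀ x y → - (x - y) ≡ - x - - y
      negate = solve-∀

    *-cong : x ≈ y → u ≈ v → x * u ≈ y * v
    *-cong {x} {y} {u} {v} x≈y u≈v =
      ∣⇒≈ (subst (m ∣_) (regroup x y u v)
        (∣m∣n⇒∣m+n (∣m⇒∣m*n u (≈⇒∣ x≈y)) (∣n⇒∣m*n y (≈⇒∣ u≈v))))
      where
      regroup : ∀ x y u v → (x - y) * u + y * (u - v) ≡ x * u - y * v
      regroup = solve-∀

    *-congˡ : ∀ x → u ≈ v → x * u ≈ x * v
    *-congˡ x = *-cong (≈-refl {x})

    *-congʳ : ∀ x → u ≈ v → u * x ≈ v * x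
    *-congʳ x u≈v = *-cong u≈v (≈-refl {x})

    ^-cong : ∀ k → x ≈ y → x ^ k ≈ y ^ k
    ^-cong zero    x≈y = ≈-refl
    ^-cong (suc k) x≈y = *-cong x≈y (^-cong k x≈y)

    ≈⇒-≈0 : x ≈ y → x - y ≈ 0ℤ
    ≈⇒-≈0 {x} {y} x≈y = ≈-trans (+-cong x≈y ≈-refl) (≈-reflexive (ℤ.+-inverseʳ y))

    -≈0⇒≈ : x - y ≈ 0ℤ → x ≈ y
    -≈0⇒≈ {x} {y} x-y≈0 = begin
      x             ≡⟨ shift x y ⟩
      (x - y) + y   ≈⟨ +-cong x-y≈0 ≈-refl ⟩
      0ℤ + y        ≡⟨ ℤ.+-identityˡ y ⟩
      y             ∎
      where
      open ≈-Reasoning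
      shift : ∀ x y → x ≡ (x - y) + y
      shift = solve-∀

    ≈0⇒∣ : x ≈ 0ℤ → m ∣ x
    ≈0⇒∣ {x} x≈0 = subst (m ∣_) (ℤ.+-identityʳ x) (≈⇒∣ x≈0)

    ∣⇒≈0 : m ∣ x → x ≈ 0ℤ
    ∣⇒≈0 {x} m∣x = ∣⇒≈ (subst (m ∣_) (sym (ℤ.+-identityʳ x)) m∣x)

  pos-+* : ∀ d i j n k → d ℕ.+ i ℕ.* j ≡ n ℕ.* k → + d + + i * + j ≡ + n * + k
  pos-+* d i j n k eq = begin
    + d + + i * + j      ≡⟨ cong (_+_ (+ d)) (ℤ.pos-* i j) ⟨
    + d + + (i ℕ.* j)    ≡⟨ ℤ.pos-+ d (i ℕ.* j) ⟨
    + (d ℕ.+ i ℕ.* j)    ≡⟨ cong +_ eq ⟩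
    + (n ℕ.* k)          ≡⟨ ℤ.pos-* n k ⟩
    + n * + k            ∎
    where open ≡-Reasoning

  bézout : ∀ i j → ∃₂ λ u v → u * + i + v * + j ≡ + gcd i j
  bézout i j with Bézout.lemma i j
  ... | Bézout.result d g (Bézout.+- s t eq) rewrite GCD.unique g (gcd-GCD i j) = + s , - + t , (begin
    + s * + i + - + t * + j               ≡⟨ cong (_+ - + t * + j) (pos-+* _ t j s i eq) ⟨
    (+ gcd i j + + t * + j) + - + t * + j ≡⟨ cancel (+ gcd i j) (+ t) (+ j) ⟩
    + gcd i j                             ∎)
    where
    open ≡-Reasoning
    cancel : ∀ d t j → (d + t * j) + - t * j ≡ d
    cancel = solve-∀
  ... | Bézout.result d g (Bézout.-+ s t eq) rewrite GCD.unique g (gcd-GCD i j) = - + s , + t , (begin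
    - + s * + i + + t * + j               ≡⟨ cong (_+_ (- + s * + i)) (pos-+* _ s i t j eq) ⟨
    - + s * + i + (+ gcd i j + + s * + i) ≡⟨ cancel (+ gcd i j) (+ s) (+ i) ⟩
    + gcd i j                             ∎)
    where
    open ≡-Reasoning
    cancel : ∀ d s i → - s * i + (d + s * i) ≡ d
    cancel = solve-∀

  inverse : ℕ → ℕ → ℤ
  inverse n i = proj₁ (bézout i n)

  module _ {n : ℕ} where
    open Congruence (+ n)

    ≈⇒≡ : i ℕ.< n → j ℕ.< n → + i ≈ + j → i ≡ j
    ≈⇒≡ {i} {j} i<n j<n i≈j with ∣ + i - + j ∣ in eq
    ... | zero  = ℤ.+-injective (ℤ.i-j≡0⇒i≡j (+ i) (+ j) (ℤ.∣i∣≡0⇒i≡0 eq))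
    ... | suc d = contradiction (ℕ.∣⇒≤ (subst (n ℕ.∣_) eq (∣⇒∣ᵤ (≈⇒∣ i≈j)))) (ℕ.<⇒≱ distance<n)
      where
      distance<n : suc d ℕ.< n
      distance<n = ℕ.≤-<-trans
        (subst (ℕ._≤ i ℕ.⊔ j) (trans (cong ∣_∣ (sym (ℤ.m-n≡m⊖n i j))) eq) (ℤ.∣m⊝n∣≤m⊔n i j))
        (ℕ.⊔-lub i<n j<n)

    ≈-%ℕ : .{{_ : NonZero n}} → x ≈ + (x %ℕ n)
    ≈-%ℕ {x} = ∣⇒≈ (divides (x /ℕ n) (begin
      x - + r                         ≡⟨ cong (_- + r) (a≡a%ℕn+[a/ℕn]*n x n) ⟩
      (+ r + (x /ℕ n) * + n) - + r    ≡⟨ cancel (+ r) ((x /ℕ n) * + n) ⟩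
      (x /ℕ n) * + n                  ∎))
      where
      open ≡-Reasoning
      r : ℕ
      r = x %ℕ n
      cancel : ∀ r s → (r + s) - r ≡ s
      cancel = solve-∀

    *-inverse : Coprime i n → + i * inverse n i ≈ 1ℤ
    *-inverse {i} coprime with bézout i n
    ... | u , v , eq = ∣⇒≈ (divides (- v) (begin
      + i * u - 1ℤ                     ≡⟨ cong (λ d → + i * u - + d) (coprime⇒gcd≡1 coprime) ⟨
      + i * u - + gcd i n              ≡⟨ cong (_-_ (+ i * u)) eq ⟨
      + i * u - (u * + i + v * + n)    ≡⟨ cancel (+ i) u v (+ n) ⟩
      - v * + n                        ∎))
      where
      open ≡-Reasoning
      cancel : ∀ i u v n → i * u - (u * i + v * n) ≡ - v * n
      cancel = solve-∀

  _≢?_ : ∀ i j → Dec (i ≢ j)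
  i ≢? j = ¬? (i ℕ.≟ j)

  remove : ℕ → List ℕ → List ℕ
  remove i = filter (_≢? i)

  ∈-remove⁺ : i ∈ xs → i ≢ j → i ∈ remove j xs
  ∈-remove⁺ = ∈-filter⁺ _

  ∈-remove⁻ : i ∈ remove j xs → i ∈ xs × i ≢ j
  ∈-remove⁻ = ∈-filter⁻ _

  remove-unique : Unique xs → Unique (remove i xs)
  remove-unique = Unique.filter⁺ _

  remove-↭ : Unique xs → i ∈ xs → xs ↭ i ∷ remove i xs
  remove-↭ {i ∷ xs} (i∉xs ∷ _) (here refl)
    rewrite filter-reject (_≢? i) {i} {xs} (λ i≢i → i≢i refl)
          | filter-all (_≢? i) (All.map (λ i≢j j≡i → i≢j (sym j≡i)) i∉xs) = ↭-refl
  remove-↭ {j ∷ xs} {i} (j∉xs ∷ unique) (there i∈xs)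
    rewrite filter-accept (_≢? i) {j} {xs} (All.lookup j∉xs i∈xs)
    = ↭-trans (↭-prep j (remove-↭ unique i∈xs)) (↭-swap j i ↭-refl)

  module Pairings (m : ℤ) where
    open Congruence m

    record Pairing (c : ℤ) (xs : List ℕ) : Set where
      field
        partner            : ℕ → ℕ
        partner-∈          : ∀ {a} → a ∈ xs → partner a ∈ xs
        partner-involutive : ∀ {a} → a ∈ xs → partner (partner a) ≡ a
        partner-≢          : ∀ {a} → a ∈ xs → partner a ≢ a
        partner-*          : ∀ {a} → a ∈ xs → + a * + partner a ≈ c

    module _ (P : Pairing c xs) {a} (a∈xs : a ∈ xs) where
      open Pairing P

      private
        a′ : ℕ
        a′ = partner a

      removePair-↭ : Unique xs → xs ↭ a ∷ a′ ∷ remove a′ (remove a xs)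
      removePair-↭ unique = ↭-trans (remove-↭ unique a∈xs)
        (↭-prep a (remove-↭ (remove-unique unique) (∈-remove⁺ (partner-∈ a∈xs) (partner-≢ a∈xs))))

      removePair : Pairing c (remove a′ (remove a xs))
      removePair = record
        { partner            = partner
        ; partner-∈          = λ b∈ → let b∈xs , b≢a , b≢a′ = unpack b∈ in
            ∈-remove⁺ (∈-remove⁺ (partner-∈ b∈xs)
              (λ b′≡a → b≢a′ (trans (sym (partner-involutive b∈xs)) (cong partner b′≡a))))
              (λ b′≡a′ → b≢a (trans (sym (partner-involutive b∈xs))
                (trans (cong partner b′≡a′) (partner-involutive a∈xs))))
        ; partner-involutive = partner-involutive ∘ proj₁ ∘ unpack
        ; partner-≢          = partner-≢ ∘ proj₁ ∘ unpack
        ; partner-*          = partner-* ∘ proj₁ ∘ unpack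
        }
        where
        unpack : ∀ {b} → b ∈ remove a′ (remove a xs) → b ∈ xs × b ≢ a × b ≢ a′
        unpack b∈ = let b∈xs-a , b≢a′ = ∈-remove⁻ b∈ ; b∈xs , b≢a = ∈-remove⁻ b∈xs-a in b∈xs , b≢a , b≢a′

    product-pairing : ∀ k → Unique xs → Pairing c xs → length xs ≡ 2 ℕ.* k → + product xs ≈ c ^ k
    product-pairing {[]}         zero    _      _ _   = ≈-refl
    product-pairing {xs@(a ∷ _)} {c} (suc k) unique P len = begin
      + product xs                      ≡⟨ cong +_ (product-↭ xs↭) ⟩
      + (a ℕ.* (a′ ℕ.* product rest))   ≡⟨ pos-*-assoc a a′ (product rest) ⟩
      (+ a * + a′) * + product rest     ≈⟨ *-cong (partner-* (here refl)) product-rest ⟩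
      c * c ^ k                         ∎
      where
      open ≈-Reasoning
      open Pairing P
      a′ : ℕ
      a′ = partner a
      rest : List ℕ
      rest = remove a′ (remove a xs)
      xs↭ : xs ↭ a ∷ a′ ∷ rest
      xs↭ = removePair-↭ P (here refl) unique
      product-rest : + product rest ≈ c ^ k
      product-rest = product-pairing k (remove-unique (remove-unique unique)) (removePair P (here refl))
        (ℕ.suc-injective (ℕ.suc-injective (trans (sym (↭-length xs↭)) (trans len (ℕ.*-suc 2 k)))))
      pos-*-assoc : ∀ a b r → + (a ℕ.* (b ℕ.* r)) ≡ (+ a * + b) * + r
      pos-*-assoc a b r =
        trans (ℤ.pos-* a (b ℕ.* r)) (trans (cong (+ a *_) (ℤ.pos-* b r)) (sym (ℤ.*-assoc (+ a) (+ b) (+ r))))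

  module PrimeModulus {p : ℕ} (prime : Prime p) where
    open Congruence (+ p)
    open Pairings (+ p)

    instance
      p≢0 : NonZero p
      p≢0 = prime⇒nonZero prime

    euclid : x * y ≈ 0ℤ → x ≈ 0ℤ ⊎ y ≈ 0ℤ
    euclid {x} {y} xy≈0 = Sum.map (∣⇒≈0 ∘ ∣ᵤ⇒∣) (∣⇒≈0 ∘ ∣ᵤ⇒∣)
      (euclidsLemma ∣ x ∣ ∣ y ∣ prime (subst (p ℕ.∣_) (ℤ.abs-* x y) (∣⇒∣ᵤ (≈0⇒∣ xy≈0))))

    *-cancelˡ : ¬ x ≈ 0ℤ → x * y ≈ x * z → y ≈ z
    *-cancelˡ {x} {y} {z} x≉0 xy≈xz =
      Sum.[ flip contradiction x≉0 , -≈0⇒≈ ] (euclid (≈-trans (≈-reflexive (factor x y z)) (≈⇒-≈0 xy≈xz)))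
      where
      factor : ∀ x y z → x * (y - z) ≡ x * y - x * z
      factor = solve-∀

    x*x≈y*y⇒x≈±y : x * x ≈ y * y → x ≈ y ⊎ x ≈ - y
    x*x≈y*y⇒x≈±y {x} {y} x²≈y² = Sum.map -≈0⇒≈ (-≈0⇒≈ ∘ ≈-trans (≈-reflexive (minus-neg x y)))
      (euclid (≈-trans (≈-reflexive (factor x y)) (≈⇒-≈0 x²≈y²)))
      where
      factor : ∀ x y → (x - y) * (x + y) ≡ x * x - y * y
      factor = solve-∀
      minus-neg : ∀ x y → x - - y ≡ x + y
      minus-neg = solve-∀

    fourthPower⇒square : IsSquare p -1ℤ → IsFourthPower p (x ^ 2) → IsSquare p x
    fourthPower⇒square {x} (i , i²≡-1) (y , y⁴≡x²) = Sum.[ (λ y²≈x → y , ≈⇒≡[mod] y²≈x) ,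
                                                          (λ y²≈-x → i * y , ≈⇒≡[mod] ([iy]²≈x y²≈-x)) ]
      (x*x≈y*y⇒x≈±y y²y²≈xx)
      where
      open ≈-Reasoning
      y²y²≈xx : y ^ 2 * y ^ 2 ≈ x * x
      y²y²≈xx = begin
        y ^ 2 * y ^ 2   ≡⟨ ℤ.^-distribˡ-+-* y 2 2 ⟨
        y ^ 4           ≈⟨ ≡[mod]⇒≈ y⁴≡x² ⟩
        x ^ 2           ≡⟨ x^2≡x*x x ⟩
        x * x           ∎
      i²≈-1 : i ^ 2 ≈ -1ℤ
      i²≈-1 = ≡[mod]⇒≈ i²≡-1
      [iy]²≈x : y ^ 2 ≈ - x → (i * y) ^ 2 ≈ x
      [iy]²≈x y²≈-x = begin
        (i * y) ^ 2     ≡⟨ distrib i y ⟩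
        i ^ 2 * y ^ 2   ≈⟨ *-cong i²≈-1 y²≈-x ⟩
        -1ℤ * - x       ≡⟨ cancel x ⟩
        x               ∎
        where
        distrib : ∀ i y → (i * y) * (i * y * 1ℤ) ≡ i * (i * 1ℤ) * (y * (y * 1ℤ))
        distrib = solve-∀
        cancel : ∀ x → -1ℤ * - x ≡ x
        cancel = solve-∀

    units : List ℕ
    units = applyUpTo suc (ℕ.pred p)

    ∈-units⁺ : 0 ℕ.< i → i ℕ.< p → i ∈ units
    ∈-units⁺ {suc i} _ i<p = ∈-applyUpTo⁺ suc (ℕ.suc[m]≤n⇒m≤pred[n] i<p)

    ∈-units⁻ : i ∈ units → 0 ℕ.< i × i ℕ.< p
    ∈-units⁻ i∈ with j , j<p-1 , refl ← ∈-applyUpTo⁻ suc i∈ = ℕ.z<s , ℕ.m≤pred[n]⇒suc[m]≤n j<p-1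

    units-unique : Unique units
    units-unique = Unique.applyUpTo⁺₁ suc (ℕ.pred p) (λ i<j _ i≡j → ℕ.<-irrefl (ℕ.suc-injective i≡j) i<j)

    length-units : length units ≡ ℕ.pred p
    length-units = length-applyUpTo suc (ℕ.pred p)

    unit≉0 : i ∈ units → ¬ + i ≈ 0ℤ
    unit≉0 i∈ i≈0 = let 0<i , i<p = ∈-units⁻ i∈ in ℕ.<⇒≢ 0<i (sym (≈⇒≡ i<p (ℕ.>-nonZero⁻¹ p) i≈0))

    p-1≈-1 : + ℕ.pred p ≈ -1ℤ
    p-1≈-1 = ∣⇒≈ (divides 1ℤ (begin
      + ℕ.pred p - -1ℤ      ≡⟨ shift (+ ℕ.pred p) ⟩
      1ℤ + + ℕ.pred p       ≡⟨ ℤ.pos-+ 1 (ℕ.pred p) ⟨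
      + suc (ℕ.pred p)      ≡⟨ cong +_ (ℕ.suc-pred p) ⟩
      + p                   ≡⟨ ℤ.*-identityˡ (+ p) ⟨
      1ℤ * + p              ∎))
      where
      open ≡-Reasoning
      shift : ∀ t → t - -1ℤ ≡ 1ℤ + t
      shift = solve-∀

    partner : ℤ → ℕ → ℕ
    partner c i = (c * inverse p i) %ℕ p

    *-partner : ∀ c → i ∈ units → + i * + partner c i ≈ c
    *-partner {i} c i∈ = begin
      + i * + partner c i         ≈⟨ *-congˡ (+ i) ≈-%ℕ ⟨
      + i * (c * inverse p i)     ≡⟨ reorder (+ i) c (inverse p i) ⟩
      c * (+ i * inverse p i)     ≈⟨ *-congˡ c (*-inverse coprime) ⟩
      c * 1ℤ                      ≡⟨ ℤ.*-identityʳ c ⟩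
      c                           ∎
      where
      open ≈-Reasoning
      reorder : ∀ i c j → i * (c * j) ≡ c * (i * j)
      reorder = solve-∀
      coprime : Coprime i p
      coprime = let 0<i , i<p = ∈-units⁻ i∈ in Coprime.sym (prime⇒coprime prime {{ℕ.>-nonZero 0<i}} i<p)

    partner-∈ : ¬ c ≈ 0ℤ → i ∈ units → partner c i ∈ units
    partner-∈ {c} {i} c≉0 i∈ = ∈-units⁺ (ℕ.n≢0⇒n>0 partner≢0) (n%ℕd<d (c * inverse p i) p)
      where
      partner≢0 : partner c i ≢ 0
      partner≢0 eq = c≉0 (≈-trans (≈-sym (*-partner c i∈))
        (≈-reflexive (trans (cong (λ j → + i * + j) eq) (ℤ.*-zeroʳ (+ i)))))

    partner-involutive : ¬ c ≈ 0ℤ → i ∈ units → partner c (partner c i) ≡ i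
    partner-involutive {c} {i} c≉0 i∈ =
      ≈⇒≡ (proj₂ (∈-units⁻ (partner-∈ c≉0 i′∈))) (proj₂ (∈-units⁻ i∈))
      (*-cancelˡ (unit≉0 i′∈) (≈-trans (*-partner c i′∈)
        (≈-sym (≈-trans (≈-reflexive (ℤ.*-comm (+ i′) (+ i))) (*-partner c i∈)))))
      where
      i′ : ℕ
      i′ = partner c i
      i′∈ : i′ ∈ units
      i′∈ = partner-∈ c≉0 i∈

    partnerPairing : ¬ c ≈ 0ℤ → (∀ {i} → i ∈ xs → i ∈ units) → (∀ {i} → i ∈ xs → partner c i ∈ xs) →
                     (∀ {i} → i ∈ xs → ¬ + i * + i ≈ c) → Pairing c xs
    partnerPairing {c} c≉0 ⊆units closed no-root = record
      { partner            = partner c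
      ; partner-∈          = closed
      ; partner-involutive = partner-involutive c≉0 ∘ ⊆units
      ; partner-≢          = λ {i} i∈ i′≡i →
          no-root i∈ (subst (λ i′ → + i * + i′ ≈ c) i′≡i (*-partner c (⊆units i∈)))
      ; partner-*          = *-partner c ∘ ⊆units
      }

  module OddPrime {p : ℕ} (prime : Prime p) {h : ℕ} (p≡1+2h : p ≡ suc (2 ℕ.* h)) where
    open Congruence (+ p)
    open Pairings (+ p)
    open PrimeModulus prime

    private
      1<p : 1 ℕ.< p
      1<p = ℕ.nonTrivial⇒n>1 p {{prime⇒nonTrivial prime}}

      1∈units : 1 ∈ units
      1∈units = ∈-units⁺ ℕ.z<s 1<p

      p-1∈units : ℕ.pred p ∈ units
      p-1∈units = ∈-units⁺ (ℕ.suc[m]≤n⇒m≤pred[n] 1<p) (ℕ.m≤pred[n]⇒suc[m]≤n ℕ.≤-refl)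

      p-1≡2h : ℕ.pred p ≡ 2 ℕ.* h
      p-1≡2h = cong ℕ.pred p≡1+2h

      p-1≢1 : ℕ.pred p ≢ 1
      p-1≢1 = ℕ.even≢odd h 0 ∘ trans (sym p-1≡2h)

      ≈±1⇒≡ : i ∈ units → + i ≈ 1ℤ ⊎ + i ≈ -1ℤ → i ≡ 1 ⊎ i ≡ ℕ.pred p
      ≈±1⇒≡ i∈ = let i<p = proj₂ (∈-units⁻ i∈) in Sum.map (≈⇒≡ i<p 1<p)
        (λ i≈-1 → ≈⇒≡ i<p (proj₂ (∈-units⁻ p-1∈units)) (≈-trans i≈-1 (≈-sym p-1≈-1)))

      rest : List ℕ
      rest = remove (ℕ.pred p) (remove 1 units)

      units↭ : units ↭ 1 ∷ ℕ.pred p ∷ rest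
      units↭ = ↭-trans (remove-↭ units-unique 1∈units)
        (↭-prep 1 (remove-↭ (remove-unique units-unique) (∈-remove⁺ p-1∈units p-1≢1)))

      length-rest : length rest ≡ 2 ℕ.* (h ℕ.∸ 1)
      length-rest = begin
        length rest                      ≡⟨ ℕ.m+n∸m≡n 2 (length rest) ⟨
        2 ℕ.+ length rest ℕ.∸ 2          ≡⟨ cong (ℕ._∸ 2) (↭-length units↭) ⟨
        length units ℕ.∸ 2               ≡⟨ cong (ℕ._∸ 2) (trans length-units p-1≡2h) ⟩
        2 ℕ.* h ℕ.∸ 2                    ≡⟨ ℕ.*-distribˡ-∸ 2 h 1 ⟨
        2 ℕ.* (h ℕ.∸ 1)                  ∎
        where open ≡-Reasoning

      unpack : i ∈ rest → i ∈ units × i ≢ 1 × i ≢ ℕ.pred p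
      unpack i∈ = let i∈units-1 , i≢p-1 = ∈-remove⁻ i∈ ; i∈units , i≢1 = ∈-remove⁻ i∈units-1 in
        i∈units , i≢1 , i≢p-1

      ≉±1 : i ∈ rest → ¬ (+ i ≈ 1ℤ ⊎ + i ≈ -1ℤ)
      ≉±1 i∈ ±1 = let i∈units , i≢1 , i≢p-1 = unpack i∈ in Sum.[ i≢1 , i≢p-1 ] (≈±1⇒≡ i∈units ±1)

      partner-∈-rest : i ∈ rest → partner 1ℤ i ∈ rest
      partner-∈-rest {i} i∈ =
        ∈-remove⁺ (∈-remove⁺ (partner-∈ (unit≉0 1∈units) i∈units) (λ i′≡1 → ≉±1 i∈ (inj₁ (begin
          + i                    ≡⟨ ℤ.*-identityʳ (+ i) ⟨
          + i * + 1              ≡⟨ cong (λ j → + i * + j) i′≡1 ⟨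
          + i * + i′             ≈⟨ *-partner 1ℤ i∈units ⟩
          1ℤ                     ∎))))
          (λ i′≡p-1 → ≉±1 i∈ (inj₂ (begin
          + i                    ≡⟨ flip-sign (+ i) ⟩
          + i * -1ℤ * -1ℤ        ≈⟨ *-congʳ -1ℤ (*-congˡ (+ i) p-1≈-1) ⟨
          + i * + ℕ.pred p * -1ℤ ≡⟨ cong (λ j → + i * + j * -1ℤ) i′≡p-1 ⟨
          + i * + i′ * -1ℤ       ≈⟨ *-congʳ -1ℤ (*-partner 1ℤ i∈units) ⟩
          1ℤ * -1ℤ               ∎)))
        where
        open ≈-Reasoning
        i∈units : i ∈ units
        i∈units = proj₁ (unpack i∈)
        i′ : ℕ
        i′ = partner 1ℤ i
        flip-sign : ∀ x → x ≡ x * -1ℤ * -1ℤ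
        flip-sign = solve-∀

      restPairing : Pairing 1ℤ rest
      restPairing = partnerPairing (unit≉0 1∈units) (proj₁ ∘ unpack) partner-∈-rest
        (λ i∈ i*i≈1 → ≉±1 i∈ (x*x≈y*y⇒x≈±y i*i≈1))

    wilson : + product units ≈ -1ℤ
    wilson = begin
      + product units                          ≡⟨ cong +_ (product-↭ units↭) ⟩
      + (1 ℕ.* (ℕ.pred p ℕ.* product rest))    ≡⟨ cong +_ (ℕ.*-identityˡ _) ⟩
      + (ℕ.pred p ℕ.* product rest)            ≡⟨ ℤ.pos-* (ℕ.pred p) (product rest) ⟩
      + ℕ.pred p * + product rest              ≈⟨ *-cong p-1≈-1 product-rest ⟩
      -1ℤ * 1ℤ ^ (h ℕ.∸ 1)                     ≡⟨ cong (-1ℤ *_) (ℤ.^-zeroˡ (h ℕ.∸ 1)) ⟩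
      -1ℤ                                      ∎
      where
      open ≈-Reasoning
      product-rest : + product rest ≈ 1ℤ ^ (h ℕ.∸ 1)
      product-rest = product-pairing (h ℕ.∸ 1) (remove-unique (remove-unique units-unique)) restPairing length-rest

    1≉-1 : ¬ 1ℤ ≈ -1ℤ
    1≉-1 1≈-1 = p-1≢1 (sym (≈⇒≡ 1<p (proj₂ (∈-units⁻ p-1∈units)) (≈-trans 1≈-1 (≈-sym p-1≈-1))))

    euler-criterion : ¬ IsSquare p x → x ^ h ≈ -1ℤ
    euler-criterion {x} nonsquare = begin
      x ^ h              ≈⟨ product-pairing h units-unique pairing (trans length-units p-1≡2h) ⟨
      + product units    ≈⟨ wilson ⟩
      -1ℤ                ∎
      where
      open ≈-Reasoning
      x≉0 : ¬ x ≈ 0ℤ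
      x≉0 x≈0 = nonsquare (0ℤ , ≈⇒≡[mod] (≈-sym x≈0))
      pairing : Pairing x units
      pairing = partnerPairing x≉0 id (partner-∈ x≉0)
        (λ {i} _ i*i≈x → nonsquare (+ i , ≈⇒≡[mod] (≈-trans (≈-reflexive (x^2≡x*x (+ i))) i*i≈x)))

  square⇒square²-isFourthPower : IsSquare n x → IsFourthPower n (x ^ 2)
  square⇒square²-isFourthPower {n} {x} (y , y²≡x) = y , ≈⇒≡[mod] (begin
    y ^ 4         ≡⟨ ℤ.^-*-assoc y 2 2 ⟨
    (y ^ 2) ^ 2   ≈⟨ ^-cong 2 y²≈x ⟩
    x ^ 2         ∎)
    where
    open Congruence (+ n)
    open ≈-Reasoning
    y²≈x : y ^ 2 ≈ x
    y²≈x = ≡[mod]⇒≈ y²≡x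

  n%4≡3⇒n≡1+2[1+2[n/4]] : n ℕ.% 4 ≡ 3 → n ≡ suc (2 ℕ.* suc (2 ℕ.* (n ℕ./ 4)))
  n%4≡3⇒n≡1+2[1+2[n/4]] {n} n%4≡3 =
    trans (ℕ.m≡m%n+[m/n]*n n 4) (trans (cong (ℕ._+ n ℕ./ 4 ℕ.* 4) n%4≡3) (regroup (n ℕ./ 4)))
    where
    regroup : ∀ k → 3 ℕ.+ k ℕ.* 4 ≡ suc (2 ℕ.* suc (2 ℕ.* k))
    regroup = ℕ-Solver.solve-∀

  n%4≡1⇒n≡1+2[2[n/4]] : n ℕ.% 4 ≡ 1 → n ≡ suc (2 ℕ.* (2 ℕ.* (n ℕ./ 4)))
  n%4≡1⇒n≡1+2[2[n/4]] {n} n%4≡1 =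
    trans (ℕ.m≡m%n+[m/n]*n n 4) (trans (cong (ℕ._+ n ℕ./ 4 ℕ.* 4) n%4≡1) (regroup (n ℕ./ 4)))
    where
    regroup : ∀ k → 1 ℕ.+ k ℕ.* 4 ≡ suc (2 ℕ.* (2 ℕ.* k))
    regroup = ℕ-Solver.solve-∀

  module _ {p : ℕ} (prime : Prime p) where
    open Congruence (+ p)
    open ≈-Reasoning

    nonsquare⇒square²-isFourthPower : p ℕ.% 4 ≡ 3 → ¬ IsSquare p x → IsFourthPower p (x ^ 2)
    nonsquare⇒square²-isFourthPower {x} p%4≡3 nonsquare = x ^ suc k , ≈⇒≡[mod] (begin
      (x ^ suc k) ^ 4           ≡⟨ ℤ.^-*-assoc x (suc k) 4 ⟩
      x ^ (suc k ℕ.* 4)         ≡⟨ cong (x ^_) (regroup k) ⟩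
      x ^ (2 ℕ.+ h ℕ.* 2)       ≡⟨ ℤ.^-distribˡ-+-* x 2 (h ℕ.* 2) ⟩
      x ^ 2 * x ^ (h ℕ.* 2)     ≡⟨ cong (x ^ 2 *_) (ℤ.^-*-assoc x h 2) ⟨
      x ^ 2 * (x ^ h) ^ 2       ≈⟨ *-congˡ (x ^ 2) (^-cong 2 (euler-criterion nonsquare)) ⟩
      x ^ 2 * -1ℤ ^ 2           ≡⟨ ℤ.*-identityʳ (x ^ 2) ⟩
      x ^ 2                     ∎)
      where
      k h : ℕ
      k = p ℕ./ 4
      h = suc (2 ℕ.* k)
      open OddPrime prime {h} (n%4≡3⇒n≡1+2[1+2[n/4]] p%4≡3)
      regroup : ∀ k → suc k ℕ.* 4 ≡ 2 ℕ.+ suc (2 ℕ.* k) ℕ.* 2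
      regroup = ℕ-Solver.solve-∀

    -- Only doubly negated: Euler's criterion refutes that -1 is a non-square, but it does not
    -- produce a square root of -1.
    ¬¬-1-isSquare : p ℕ.% 4 ≡ 1 → ¬ ¬ IsSquare p -1ℤ
    ¬¬-1-isSquare p%4≡1 nonsquare = 1≉-1 (begin
      1ℤ                 ≡⟨ ℤ.^-zeroˡ k ⟨
      (-1ℤ ^ 2) ^ k      ≡⟨ ℤ.^-*-assoc -1ℤ 2 k ⟩
      -1ℤ ^ (2 ℕ.* k)    ≈⟨ euler-criterion nonsquare ⟩
      -1ℤ                ∎)
      where
      k : ℕ
      k = p ℕ./ 4
      open OddPrime prime {2 ℕ.* k} (n%4≡1⇒n≡1+2[2[n/4]] p%4≡1)

    nonsquare⇒square²-notFourthPower : p ℕ.% 4 ≡ 1 → ¬ IsSquare p x → ¬ IsFourthPower p (x ^ 2)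
    nonsquare⇒square²-notFourthPower p%4≡1 nonsquare fourthPower =
      ¬¬-1-isSquare p%4≡1 (λ -1-square → nonsquare (fourthPower⇒square -1-square fourthPower))
      where open PrimeModulus prime

  [i*j]%4≡3⇒ : ∀ i j → (i ℕ.* j) ℕ.% 4 ≡ 3 →
               (i ℕ.% 4 ≡ 3 × j ℕ.% 4 ≡ 1) ⊎ (i ℕ.% 4 ≡ 1 × j ℕ.% 4 ≡ 3)
  [i*j]%4≡3⇒ i j ij%4≡3 =
    residues (i ℕ.% 4) (j ℕ.% 4) (ℕ.m%n<n i 4) (ℕ.m%n<n j 4) (trans (sym (ℕ.%-distribˡ-* i j 4)) ij%4≡3)
    where
    residues : ∀ r s → r ℕ.< 4 → s ℕ.< 4 → (r ℕ.* s) ℕ.% 4 ≡ 3 → (r ≡ 3 × s ≡ 1) ⊎ (r ≡ 1 × s ≡ 3)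
    residues 3 1 _ _ _ = inj₁ (refl , refl)
    residues 1 3 _ _ _ = inj₂ (refl , refl)
    residues 0 _ _ _ ()
    residues 1 0 _ _ ()
    residues 1 1 _ _ ()
    residues 1 2 _ _ ()
    residues 2 0 _ _ ()
    residues 2 1 _ _ ()
    residues 2 2 _ _ ()
    residues 2 3 _ _ ()
    residues 3 0 _ _ ()
    residues 3 2 _ _ ()
    residues 3 3 _ _ ()
    residues (suc (suc (suc (suc _)))) _ (ℕ.s≤s (ℕ.s≤s (ℕ.s≤s (ℕ.s≤s ())))) _ _
    residues _ (suc (suc (suc (suc _)))) _ (ℕ.s≤s (ℕ.s≤s (ℕ.s≤s (ℕ.s≤s ())))) _

  distinct-primes⇒coprime : Prime i → Prime j → i ≢ j → Coprime i j
  distinct-primes⇒coprime prime-i prime-j i≢j (d∣i , d∣j) with prime⇒irreducible prime-i d∣i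
  ... | inj₁ d≡1 = d≡1
  ... | inj₂ refl with prime⇒irreducible prime-j d∣j
  ...   | inj₁ refl = contradiction prime-i ¬prime[1]
  ...   | inj₂ i≡j  = contradiction i≡j i≢j

  coprime⇒*∣ : Coprime i j → i ℕ.∣ n → j ℕ.∣ n → i ℕ.* j ℕ.∣ n
  coprime⇒*∣ {i} {j} coprime i∣n j∣n = subst (ℕ._∣ _) lcm≡i*j (lcm-least i∣n j∣n)
    where
    lcm≡i*j : lcm i j ≡ i ℕ.* j
    lcm≡i*j = begin
      lcm i j             ≡⟨ ℕ.*-identityˡ (lcm i j) ⟨
      1 ℕ.* lcm i j       ≡⟨ cong (ℕ._* lcm i j) (coprime⇒gcd≡1 coprime) ⟨
      gcd i j ℕ.* lcm i j ≡⟨ gcd*lcm i j ⟩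
      i ℕ.* j             ∎
      where open ≡-Reasoning

  bézout-idempotent : Coprime i j → ∃ λ e → (e ≡ 1ℤ [mod + i ]) × (e ≡ 0ℤ [mod + j ])
  bézout-idempotent {i} {j} coprime with bézout i j
  ... | u , v , eq = v * + j , ∣⇒∣ᵤ (divides (- u) (begin
    v * + j - 1ℤ                     ≡⟨ cong (λ d → v * + j - + d) (coprime⇒gcd≡1 coprime) ⟨
    v * + j - + gcd i j              ≡⟨ cong (_-_ (v * + j)) eq ⟨
    v * + j - (u * + i + v * + j)    ≡⟨ cancel u (+ i) v (+ j) ⟩
    - u * + i                        ∎)) , ∣⇒∣ᵤ (divides v (ℤ.+-identityʳ (v * + j)))
    where
    open ≡-Reasoning
    cancel : ∀ u i v j → v * j - (u * i + v * j) ≡ - u * i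
    cancel = solve-∀

  -- Opaque because type checking otherwise unfolds the witness, through the extended Euclidean
  -- algorithm on open terms, and runs out of memory.
  opaque
    chinese-remainder : Coprime i j → ∀ y z → ∃ λ w → (w ≡ y [mod + i ]) × (w ≡ z [mod + j ])
    chinese-remainder {i} {j} coprime y z =
      let e , e≡1 , e≡0 = bézout-idempotent coprime in
      y * e + z * (1ℤ - e) , blend {+ i} e≡1 (at-1 y z) , blend {+ j} e≡0 (at-0 y z)
      where
      blend : ∀ {m e c w} → e ≡ c [mod m ] → y * c + z * (1ℤ - c) ≡ w → (y * e + z * (1ℤ - e)) ≡ w [mod m ]
      blend {m} {e} {c} e≡c eq = ≈⇒≡[mod] (≈-trans
        (+-cong (*-congˡ y e≈c) (*-congˡ z (+-cong (≈-refl {1ℤ}) (-‿cong e≈c)))) (≈-reflexive eq))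
        where
        open Congruence m
        e≈c : e ≈ c
        e≈c = ≡[mod]⇒≈ e≡c
      at-1 : ∀ y z → y * 1ℤ + z * (1ℤ - 1ℤ) ≡ y
      at-1 = solve-∀
      at-0 : ∀ y z → y * 0ℤ + z * (1ℤ - 0ℤ) ≡ z
      at-0 = solve-∀

  square⇒squares : IsSquareMod (i ℕ.* j) x → IsSquare i x × IsSquare j x
  square⇒squares {i} {j} (w , ij∣) = (w , ℕ.∣-trans (ℕ.m∣m*n j) ij∣) , (w , ℕ.∣-trans (ℕ.n∣m*n i) ij∣)

  squares⇒square : Coprime i j → IsSquare i x → IsSquare j x → IsSquareMod (i ℕ.* j) x
  squares⇒square {i} {j} {x} coprime (y , y²≡x) (z , z²≡x) with chinese-remainder coprime y z
  ... | w , w≡y , w≡z = w , coprime⇒*∣ coprime (w²≡x y²≡x w≡y) (w²≡x z²≡x w≡z)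
    where
    w²≡x : ∀ {n y} → (y ^ 2) ≡ x [mod + n ] → w ≡ y [mod + n ] → (w ^ 2) ≡ x [mod + n ]
    w²≡x {n} {y} y²≡x w≡y = ≈⇒≡[mod] (≈-trans (^-cong 2 w≈y) (≡[mod]⇒≈ y²≡x))
      where
      open Congruence (+ n)
      w≈y : w ≈ y
      w≈y = ≡[mod]⇒≈ w≡y

  BothOrNeither : Set → Set → Set
  BothOrNeither A B = (A × B) ⊎ (¬ A × ¬ B)

  ¬bothOrNeither : ∀ {A B : Set} → (A × ¬ B) ⊎ (¬ A × B) → ¬ BothOrNeither A B
  ¬bothOrNeither (inj₁ (_ , ¬b)) (inj₁ (_ , b))  = ¬b b
  ¬bothOrNeither (inj₁ (a , _))  (inj₂ (¬a , _)) = ¬a a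
  ¬bothOrNeither (inj₂ (¬a , _)) (inj₁ (a , _))  = ¬a a
  ¬bothOrNeither (inj₂ (_ , b))  (inj₂ (_ , ¬b)) = ¬b b

  symbol≡1⇔bothOrNeither : ∀ {k p q} →
    SymbolIsOne k x (p ∷ q ∷ []) ⇔ BothOrNeither (PowRes k p x) (PowRes k q x)
  symbol≡1⇔bothOrNeither = mk⇔ to from
    where
    to : ∀ {k p q} → SymbolIsOne k x (p ∷ q ∷ []) → BothOrNeither (PowRes k p x) (PowRes k q x)
    to (_ , sym-cons (sym-res r)    (sym-cons (sym-res s)    sym-nil) , _)  = inj₁ (r , s)
    to (_ , sym-cons (sym-nonres r) (sym-cons (sym-nonres s) sym-nil) , _)  = inj₂ (r , s)
    to (_ , sym-cons (sym-res _)    (sym-cons (sym-nonres _) sym-nil) , ())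
    to (_ , sym-cons (sym-nonres _) (sym-cons (sym-res _)    sym-nil) , ())
    from : ∀ {k p q} → BothOrNeither (PowRes k p x) (PowRes k q x) → SymbolIsOne k x (p ∷ q ∷ [])
    from (inj₁ (r , s)) = _ , sym-cons (sym-res r)    (sym-cons (sym-res s)    sym-nil) , refl
    from (inj₂ (r , s)) = _ , sym-cons (sym-nonres r) (sym-cons (sym-nonres s) sym-nil) , refl

  nonsquares⇒¬bothOrNeither-fourthPowers :
    Prime i → Prime j → (i ℕ.* j) ℕ.% 4 ≡ 3 → ¬ IsSquare i x → ¬ IsSquare j x →
    ¬ BothOrNeither (IsFourthPower i (x ^ 2)) (IsFourthPower j (x ^ 2))
  nonsquares⇒¬bothOrNeither-fourthPowers {i} {j} prime-i prime-j ij%4≡3 ¬square-i ¬square-j =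
    ¬bothOrNeither (Sum.map
      (λ (i%4≡3 , j%4≡1) → nonsquare⇒square²-isFourthPower prime-i i%4≡3 ¬square-i ,
                           nonsquare⇒square²-notFourthPower prime-j j%4≡1 ¬square-j)
      (λ (i%4≡1 , j%4≡3) → nonsquare⇒square²-notFourthPower prime-i i%4≡1 ¬square-i ,
                           nonsquare⇒square²-isFourthPower prime-j j%4≡3 ¬square-j)
      ([i*j]%4≡3⇒ i j ij%4≡3))

open import Data.Nat using (ℕ; _*_; _%_)
open import Data.Nat.Primality using (Prime)
open import Data.Integer using (ℤ; +_; ∣_∣) renaming (_^_ to _^ℤ_)
open import Data.Nat.GCD using (gcd)
open import Data.List using (_∷_; [])
open import Relation.Binary.PropositionalEquality using (_≡_; _≢_)
open import Function.Bundles using (_⇔_)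
open import Function using (Equivalence; mk⇔)
open import Data.Sum using (inj₁; inj₂)
open import Data.Product using (_,_)
open import Relation.Nullary using (contradiction)
open QuadraticResidues

corollary2 : (p q : ℕ) → Prime p → Prime q → p ≢ q → (p * q) % 4 ≡ 3 →
    (a : ℤ) → gcd ∣ a ∣ (p * q) ≡ 1 → SymbolIsOne 1 a (p ∷ q ∷ []) →
    (IsSquareMod (p * q) a ⇔ SymbolIsOne 2 (a ^ℤ 2) (p ∷ q ∷ []))
corollary2 p q prime-p prime-q p≢q pq%4≡3 a _ symbol₂≡1 = mk⇔ to from
  where
  to : IsSquareMod (p * q) a → SymbolIsOne 2 (a ^ℤ 2) (p ∷ q ∷ [])
  to square = let square-p , square-q = square⇒squares square in
    Equivalence.from symbol≡1⇔bothOrNeither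
      (inj₁ (square⇒square²-isFourthPower square-p , square⇒square²-isFourthPower square-q))
  from : SymbolIsOne 2 (a ^ℤ 2) (p ∷ q ∷ []) → IsSquareMod (p * q) a
  from symbol₄≡1 with Equivalence.to symbol≡1⇔bothOrNeither symbol₂≡1
  ... | inj₁ (square-p , square-q)   =
    squares⇒square (distinct-primes⇒coprime prime-p prime-q p≢q) square-p square-q
  ... | inj₂ (¬square-p , ¬square-q) = contradiction (Equivalence.to symbol≡1⇔bothOrNeither symbol₄≡1)
    (nonsquares⇒¬bothOrNeither-fourthPowers prime-p prime-q pq%4≡3 ¬square-p ¬square-q)
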